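{- Let $0=s_1<\dots<s_k$ be integers, $S=\{s_1,\dots,s_k\}$, $\bar s=s_k$, and $n\ge 2\bar s$. (a) If $T\subseteq E_C(n)$ is a cycle-cover of $C_n$, then $T\setminus\mathrm{Hook}(n)$ is a legal cover of $L_n$. (b) If $T\subseteq E_L(n+1)$ is a legal cover of $L_{n+1}$, then $T\setminus\mathrm{New}(n)$ is a legal cover of $L_n$.
   Context: Let $V(n)=\{0,\dots,n-1\}$. The circulant graph $C_n$ has vertex set $V(n)$ and edge set $E_C(n)=\{(i,j)\in V(n)^2:(j-i)\bmod n\in S\}$. The lattice graph $L_n$ has vertex set $V(n)$ and edge set $E_L(n)=\{(i,j)\in V(n)^2:j-i\in S\}$. Put $\mathrm{Hook}(n)=E_C(n)\setminus E_L(n)$, $\mathrm{New}(n)=E_L(n+1)\setminus E_L(n)$, $L(n)=\{0,\dots,\bar s-1\}$ and $R(n)=\{n-\bar s,\dots,n-1\}$. For an edge set $T$ and a vertex $v$, $\mathrm{ID}_T(v)$ and $\mathrm{OD}_T(v)$ are the in-degree and out-degree of $v$ in $(V,T)$. A cycle-cover of $C_n$ is a set $T\subseteq E_C(n)$ with $\mathrm{ID}_T(v)=\mathrm{OD}_T(v)=1$ for all $v\in V(n)$. A set $T\subseteq E_L(n)$ is a legal cover of $L_n$ if $\mathrm{ID}_T(v)\le1$ and $\mathrm{OD}_T(v)\le1$ for all $v\in V(n)$, $\mathrm{ID}_T(v)=1$ for all $v\in V(n)\setminus L(n)$, and $\mathrm{OD}_T(v)=1$ for all $v\in V(n)\setminus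 R(n)$. -}

module Defs where

open import Data.Nat using (ℕ; zero; suc; _+_; _∸_; _*_; _<_; _≤_; _<ᵇ_; _≤ᵇ_; _≡ᵇ_)
open import Data.Nat.DivMod using (_%_)
open import Data.Bool using (Bool; true; false; _∧_; not; if_then_else_)
open import Data.List using (List; []; _∷_; last)
open import Data.Bool.ListAction using (any)
open import Data.Maybe using (maybe)
open import Data.Product using (_×_)
open import Relation.Binary.PropositionalEquality using (_≡_)

EdgeSet : Set
EdgeSet = ℕ → ℕ → Bool

inS : List ℕ → ℕ → Bool
inS S d = any (λ s → d ≡ᵇ s) S

-- s̄ = s_k, the last (= largest) element of S.
sbar : List ℕ → ℕ
sbar S = maybe (λ x → x) 0 (last S)

-- E_C(n) = {(i,j) ∈ V(n)² : (j - i) mod n ∈ S};  for i,j < n, (j-i) mod n = (j + n ∸ i) % n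
EC : List ℕ → (n : ℕ) → EdgeSet
EC S zero i j = false
EC S (suc m) i j = (i <ᵇ suc m) ∧ (j <ᵇ suc m) ∧ inS S (((j + suc m) ∸ i) % suc m)

-- E_L(n) = {(i,j) ∈ V(n)² : j - i ∈ S}  (S ⊆ ℕ, so this needs i ≤ j)
EL : List ℕ → (n : ℕ) → EdgeSet
EL S n i j = (i <ᵇ n) ∧ (j <ᵇ n) ∧ (i ≤ᵇ j) ∧ inS S (j ∸ i)

_∖_ : EdgeSet → EdgeSet → EdgeSet
(A ∖ B) i j = A i j ∧ not (B i j)

_⊆E_ : EdgeSet → EdgeSet → Set
A ⊆E B = ∀ i j → A i j ≡ true → B i j ≡ true

Hook : List ℕ → ℕ → EdgeSet
Hook S n = EC S n ∖ EL S n

New : List ℕ → ℕ → EdgeSet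
New S n = EL S (suc n) ∖ EL S n

count : ℕ → (ℕ → Bool) → ℕ
count zero f = 0
count (suc m) f = (if f m then 1 else 0) + count m f

ID : ℕ → EdgeSet → ℕ → ℕ
ID n T v = count n (λ u → T u v)

OD : ℕ → EdgeSet → ℕ → ℕ
OD n T v = count n (λ u → T v u)

CycleCover : List ℕ → ℕ → EdgeSet → Set
CycleCover S n T =
  T ⊆E EC S n ×
  (∀ v → v < n → ID n T v ≡ 1 × OD n T v ≡ 1)

-- legal cover of L_n;  L(n) = {0,…,s̄-1},  R(n) = {n-s̄,…,n-1}
LegalCover : List ℕ → ℕ → EdgeSet → Set
LegalCover S n T =
  T ⊆E EL S n ×
  (∀ v → v < n → ID n T v ≤ 1 × OD n T v ≤ 1) ×
  (∀ v → v < n → sbar S ≤ v → ID n T v ≡ 1) ×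
  (∀ v → v < n → v < n ∸ sbar S → OD n T v ≡ 1)

module Submission where

-- If T' ⊆ T, the degrees of T' inside V(n) are at most the
--   degrees of T inside V(N) for n ≤ N; and if a vertex has T-degree exactly 1
--   and its unique T-neighbour is a T'-neighbour lying in V(n), its T'-degree
--   is exactly 1.  The lemma `legal-restriction` packages this: a legal cover
--   of L_n arises from T whenever every T-edge at a vertex that must have
--   degree 1 survives in T'.
-- * Geometry.  Every element of S is at most s̄.  Hence (a) an edge of C_n
--   entering v ≥ s̄, or leaving u < n - s̄, does not wrap around and so is an
--   edge of L_n; and (b) an edge of L_{n+1} entering v < n, or leaving
--   u < n - s̄, has both ends in V(n) and so is an edge of L_n.
--
-- Part (a) and part (b) are then instances of `legal-restriction`.

open import Defs
open import Data.Nat using (ℕ; _<_; _≤_; _*_; suc)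
open import Data.List using (List; _∷_)
open import Data.List.Relation.Unary.Linked using (Linked)
open import Data.Product using (_×_)

open import Data.Nat using (zero; _+_; _∸_; _≡ᵇ_; _≤?_; z≤n; s≤s; s≤s⁻¹; NonZero)
open import Data.Nat.Properties
open import Data.Nat.DivMod using (_%_; [m+n]%n≡m%n; m<n⇒m%n≡m)
open import Data.Bool using (true; false; _∧_; T)
open import Data.Product using (_,_; proj₁; proj₂)
open import Data.Sum using (_⊎_; inj₁; inj₂)
open import Data.Unit using (tt)
open import Data.Empty using (⊥-elim)
open import Relation.Nullary using (yes; no)
open import Relation.Binary.PropositionalEquality
open import Data.List.Relation.Unary.Linked using ([-]; _∷_)

toT : ∀ {b} → b ≡ true → T b
toT refl = tt

fromT : ∀ {b} → T b → b ≡ true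
fromT {true} _ = refl

∧-split : ∀ {a b} → a ∧ b ≡ true → a ≡ true × b ≡ true
∧-split {true} h = refl , h

∖-⊆ : ∀ (A B : EdgeSet) → (A ∖ B) ⊆E A
∖-⊆ A B i j h = proj₁ (∧-split h)

trim-⊆ : ∀ (T A L : EdgeSet) → T ⊆E A → (T ∖ (A ∖ L)) ⊆E L
trim-⊆ T A L T⊆A i j h with T i j in t | A i j in a | L i j
... | true  | _     | true  = refl
... | true  | true  | false = h
... | true  | false | false with trans (sym (T⊆A i j t)) a
...   | ()

trim-keeps : ∀ (T A L : EdgeSet) i j → T i j ≡ true → L i j ≡ true → (T ∖ (A ∖ L)) i j ≡ true
trim-keeps T A L i j t l rewrite t | l with A i j
... | true  = refl
... | false = refl

EL-parts : ∀ S n i j → EL S n i j ≡ true → i < n × j < n × i ≤ j × inS S (j ∸ i) ≡ true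
EL-parts S n i j h with ∧-split h
... | i< , h₁ with ∧-split h₁
... | j< , h₂ with ∧-split h₂
... | i≤j , d = <ᵇ⇒< i n (toT i<) , <ᵇ⇒< j n (toT j<) , ≤ᵇ⇒≤ i j (toT i≤j) , d

EL-intro : ∀ S n i j → i < n → j < n → i ≤ j → inS S (j ∸ i) ≡ true → EL S n i j ≡ true
EL-intro S n i j i< j< i≤j d
  rewrite fromT (<⇒<ᵇ i<) | fromT (<⇒<ᵇ j<) | fromT (≤⇒≤ᵇ i≤j) = d

EL-ordered : ∀ S N i j → EL S N i j ≡ true → i ≤ j
EL-ordered S N i j e = proj₁ (proj₂ (proj₂ (EL-parts S N i j e)))

EL-shrink : ∀ S N n i j → i < n → j < n → EL S N i j ≡ true → EL S n i j ≡ true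
EL-shrink S N n i j i< j< e with EL-parts S N i j e
... | _ , _ , i≤j , d = EL-intro S n i j i< j< i≤j d

EC-parts : ∀ S m i j → EC S (suc m) i j ≡ true →
  i < suc m × j < suc m × inS S ((j + suc m ∸ i) % suc m) ≡ true
EC-parts S m i j h with ∧-split h
... | i< , h₁ with ∧-split h₁
... | j< , d = <ᵇ⇒< i (suc m) (toT i<) , <ᵇ⇒< j (suc m) (toT j<) , d

-- The property of S that the whole argument uses.
Bounded : List ℕ → Set
Bounded S = ∀ d → inS S d ≡ true → d ≤ sbar S

head≤sbar : ∀ {x xs} → Linked _<_ (x ∷ xs) → x ≤ sbar (x ∷ xs)
head≤sbar [-]       = ≤-refl
head≤sbar (x<y ∷ l) = ≤-trans (<⇒≤ x<y) (head≤sbar l)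

increasing-bounded : ∀ {x xs} → Linked _<_ (x ∷ xs) → Bounded (x ∷ xs)
increasing-bounded {x} {xs} l d h with d ≡ᵇ x in d≡x
... | true rewrite ≡ᵇ⇒≡ d x (toT d≡x) = head≤sbar l
increasing-bounded {x} {_ ∷ _} (_ ∷ l) d h | false = increasing-bounded l d h

EL-target-bound : ∀ S N v u → Bounded S → EL S N v u ≡ true → u ≤ v + sbar S
EL-target-bound S N v u B e with EL-parts S N v u e
... | _ , _ , v≤u , d = begin
  u                ≡⟨ sym (m+[n∸m]≡n v≤u) ⟩
  v + (u ∸ v)      ≤⟨ +-monoʳ-≤ v (B (u ∸ v) d) ⟩
  v + sbar S       ∎
  where open ≤-Reasoning

<∸⇒+< : ∀ {v s n} → v < n ∸ s → v + s < n
<∸⇒+< {v} {s} {n} v< with s ≤? n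
... | yes s≤n = m≤o∸n⇒m+n≤o (suc v) s≤n v<
... | no  s≰n rewrite m≤n⇒m∸n≡0 (<⇒≤ (≰⇒> s≰n)) with v<
...   | ()

circ-forward : ∀ N a b → .{{_ : NonZero N}} → a ≤ b → b < N → (b + N ∸ a) % N ≡ b ∸ a
circ-forward N a b a≤b b<N = begin
  (b + N ∸ a) % N   ≡⟨ cong (_% N) (+-∸-comm N a≤b) ⟩
  (b ∸ a + N) % N   ≡⟨ [m+n]%n≡m%n (b ∸ a) N ⟩
  (b ∸ a) % N       ≡⟨ m<n⇒m%n≡m (≤-<-trans (m∸n≤m b a) b<N) ⟩
  b ∸ a             ∎
  where open ≡-Reasoning

circ-backward : ∀ N a b → .{{_ : NonZero N}} → b < a → a < N → (b + N ∸ a) % N + a ≡ b + N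
circ-backward N a b b<a a<N =
  trans (cong (_+ a) (m<n⇒m%n≡m d<N)) (m∸n+n≡m a≤b+N)
  where
  a≤b+N : a ≤ b + N
  a≤b+N = ≤-trans (<⇒≤ a<N) (m≤n+m N b)
  d<N : b + N ∸ a < N
  d<N = +-cancelʳ-< b (b + N ∸ a) N (begin-strict
    b + N ∸ a + b    <⟨ +-monoʳ-< (b + N ∸ a) b<a ⟩
    b + N ∸ a + a    ≡⟨ m∸n+n≡m a≤b+N ⟩
    b + N            ≡⟨ +-comm b N ⟩
    N + b            ∎)
    where open ≤-Reasoning

-- An edge (a, b) of C_N that enters b ≥ s̄, or leaves a with a + s̄ < N,
-- cannot wrap around (that would force b + N ≤ a + s̄), so it is an edge of L_N.
EC⇒EL : ∀ S N a b → Bounded S → EC S N a b ≡ true →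
  (sbar S ≤ b ⊎ a + sbar S < N) → EL S N a b ≡ true
EC⇒EL S (suc m) a b B e short with EC-parts S m a b e
... | a< , b< , d with a ≤? b
...   | yes a≤b = EL-intro S (suc m) a b a< b< a≤b
                    (subst (λ x → inS S x ≡ true) (circ-forward (suc m) a b a≤b b<) d)
...   | no  a≰b = ⊥-elim (<⇒≱ (no-wrap short) wrap)
  where
  N = suc m
  wrap : b + N ≤ a + sbar S
  wrap = begin
    b + N                    ≡⟨ sym (circ-backward N a b (≰⇒> a≰b) a<) ⟩
    (b + N ∸ a) % N + a      ≤⟨ +-monoˡ-≤ a (B _ d) ⟩
    sbar S + a               ≡⟨ +-comm (sbar S) a ⟩
    a + sbar S               ∎
    where open ≤-Reasoning
  no-wrap : (sbar S ≤ b ⊎ a + sbar S < N) → a + sbar S < b + N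
  no-wrap (inj₁ s≤b) = subst (a + sbar S <_) (+-comm N b) (+-mono-<-≤ a< s≤b)
  no-wrap (inj₂ as<N) = <-≤-trans as<N (m≤n+m N b)

count-mono : ∀ m f g → (∀ u → u < m → f u ≡ true → g u ≡ true) → count m f ≤ count m g
count-mono zero    f g f⇒g = ≤-refl
count-mono (suc m) f g f⇒g with f m in fm | g m in gm
... | true  | true  = s≤s (count-mono m f g (λ u u< → f⇒g u (m<n⇒m<1+n u<)))
... | false | true  = m≤n⇒m≤1+n (count-mono m f g (λ u u< → f⇒g u (m<n⇒m<1+n u<)))
... | false | false = count-mono m f g (λ u u< → f⇒g u (m<n⇒m<1+n u<))
... | true  | false with trans (sym (f⇒g m ≤-refl fm)) gm
...   | ()

count-extend : ∀ f {n} N → n ≤ N → count n f ≤ count N f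
count-extend f zero    z≤n = ≤-refl
count-extend f (suc N) n≤ with m≤n⇒m<n∨m≡n n≤
... | inj₂ refl = ≤-refl
... | inj₁ n<   = ≤-trans (count-extend f N (s≤s⁻¹ n<)) (m≤n+m (count N f) _)

count-beyond : ∀ f {n} N → n ≤ N → (∀ u → n ≤ u → u < N → f u ≡ false) → count N f ≡ count n f
count-beyond f zero    z≤n _ = refl
count-beyond f (suc N) n≤ none with m≤n⇒m<n∨m≡n n≤
... | inj₂ refl = refl
... | inj₁ n< rewrite none N (s≤s⁻¹ n<) ≤-refl =
  count-beyond f N (s≤s⁻¹ n<) (λ u n≤u u< → none u n≤u (m<n⇒m<1+n u<))

count-bound : ∀ {n N} f g → n ≤ N → (∀ u → g u ≡ true → f u ≡ true) → count n g ≤ count N f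
count-bound {n} {N} f g n≤N g⇒f =
  ≤-trans (count-mono n g f (λ u _ → g⇒f u)) (count-extend f N n≤N)

count-restrict : ∀ {n N} f g → n ≤ N → (∀ u → g u ≡ true → f u ≡ true) →
  (∀ u → u < N → f u ≡ true → u < n × g u ≡ true) → count N f ≡ 1 → count n g ≡ 1
count-restrict {n} {N} f g n≤N g⇒f f⇒g one =
  ≤-antisym (subst (count n g ≤_) one (count-bound f g n≤N g⇒f)) (begin
    1           ≡⟨ sym one ⟩
    count N f   ≡⟨ count-beyond f N n≤N no-witness ⟩
    count n f   ≤⟨ count-mono n f g (λ u u<n fu → proj₂ (f⇒g u (<-≤-trans u<n n≤N) fu)) ⟩
    count n g   ∎)
  where
  open ≤-Reasoning
  no-witness : ∀ u → n ≤ u → u < N → f u ≡ false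
  no-witness u n≤u u<N with f u in fu
  ... | false = refl
  ... | true  = ⊥-elim (<⇒≱ (proj₁ (f⇒g u u<N fu)) n≤u)

InSurvives OutSurvives : ℕ → ℕ → EdgeSet → EdgeSet → ℕ → Set
InSurvives  n N T T' v = ∀ u → u < N → T u v ≡ true → u < n × T' u v ≡ true
OutSurvives n N T T' v = ∀ u → u < N → T v u ≡ true → u < n × T' v u ≡ true

legal-restriction : ∀ S n N (T T' : EdgeSet) → n ≤ N → T' ⊆E EL S n → T' ⊆E T →
  (∀ v → v < n → ID N T v ≤ 1 × OD N T v ≤ 1) →
  (∀ v → v < n → sbar S ≤ v → ID N T v ≡ 1 × InSurvives n N T T' v) →
  (∀ v → v < n → v < n ∸ sbar S → OD N T v ≡ 1 × OutSurvives n N T T' v) →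
  LegalCover S n T'
legal-restriction S n N T T' n≤N T'⊆EL T'⊆T deg ins outs = T'⊆EL , degrees , in-one , out-one
  where
  degrees : ∀ v → v < n → ID n T' v ≤ 1 × OD n T' v ≤ 1
  degrees v v< =
    ≤-trans (count-bound _ _ n≤N (λ u → T'⊆T u v)) (proj₁ (deg v v<)) ,
    ≤-trans (count-bound _ _ n≤N (λ u → T'⊆T v u)) (proj₂ (deg v v<))
  in-one : ∀ v → v < n → sbar S ≤ v → ID n T' v ≡ 1
  in-one v v< s≤v with ins v v< s≤v
  ... | one , survive = count-restrict _ _ n≤N (λ u → T'⊆T u v) survive one
  out-one : ∀ v → v < n → v < n ∸ sbar S → OD n T' v ≡ 1
  out-one v v< short with outs v v< short
  ... | one , survive = count-restrict _ _ n≤N (λ u → T'⊆T v u) survive one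

-- (a) Removing the hook edges from a cycle-cover of C_n: an edge entering
-- v ≥ s̄ or leaving v < n - s̄ is not a hook edge, so it survives.
cycle-cover⇒legal : ∀ S → Bounded S → ∀ n T → CycleCover S n T → LegalCover S n (T ∖ Hook S n)
cycle-cover⇒legal S B n T (T⊆EC , deg) =
  legal-restriction S n n T T' ≤-refl (trim-⊆ T (EC S n) (EL S n) T⊆EC) (∖-⊆ T (Hook S n))
    (λ v v< → ≤-reflexive (proj₁ (deg v v<)) , ≤-reflexive (proj₂ (deg v v<)))
    (λ v v< s≤v → proj₁ (deg v v<) , entering v s≤v)
    (λ v v< short → proj₂ (deg v v<) , leaving v short)
  where
  T' = T ∖ Hook S n
  keep : ∀ a b → T a b ≡ true → (sbar S ≤ b ⊎ a + sbar S < n) → T' a b ≡ true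
  keep a b t short = trim-keeps T (EC S n) (EL S n) a b t (EC⇒EL S n a b B (T⊆EC a b t) short)
  entering : ∀ v → sbar S ≤ v → InSurvives n n T T' v
  entering v s≤v u u< t = u< , keep u v t (inj₁ s≤v)
  leaving : ∀ v → v < n ∸ sbar S → OutSurvives n n T T' v
  leaving v short u u< t = u< , keep v u t (inj₂ (<∸⇒+< short))

-- (b) Removing the edges at the new vertex n from a legal cover of L_{n+1}:
-- an edge entering v < n starts at most at v, and an edge leaving v < n - s̄
-- ends at most at v + s̄ < n, so both survive.
legal-shrink : ∀ S → Bounded S → ∀ n T → LegalCover S (suc n) T → LegalCover S n (T ∖ New S n)
legal-shrink S B n T (T⊆EL , deg , ins , outs) =
  legal-restriction S n (suc n) T T' (n≤1+n n) (trim-⊆ T (EL S (suc n)) (EL S n) T⊆EL)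
    (∖-⊆ T (New S n))
    (λ v v< → deg v (m<n⇒m<1+n v<))
    (λ v v< s≤v → ins v (m<n⇒m<1+n v<) s≤v , entering v v<)
    (λ v v< short → outs v (m<n⇒m<1+n v<) (<-≤-trans short (∸-monoˡ-≤ (sbar S) (n≤1+n n))) ,
                    leaving v v< short)
  where
  T' = T ∖ New S n
  keep : ∀ a b → a < n → b < n → T a b ≡ true → T' a b ≡ true
  keep a b a< b< t =
    trim-keeps T (EL S (suc n)) (EL S n) a b t (EL-shrink S (suc n) n a b a< b< (T⊆EL a b t))
  entering : ∀ v → v < n → InSurvives n (suc n) T T' v
  entering v v< u _ t = u< , keep u v u< v< t
    where
    u< : u < n
    u< = ≤-<-trans (EL-ordered S (suc n) u v (T⊆EL u v t)) v<
  leaving : ∀ v → v < n → v < n ∸ sbar S → OutSurvives n (suc n) T T' v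
  leaving v v< short u _ t = u< , keep v u v< u< t
    where
    u< : u < n
    u< = ≤-<-trans (EL-target-bound S (suc n) v u B (T⊆EL v u t)) (<∸⇒+< short)

lemma2 : (rest : List ℕ) → Linked _<_ (0 ∷ rest) →
    ((n : ℕ) → 2 * sbar (0 ∷ rest) ≤ n → (T : EdgeSet) →
      CycleCover (0 ∷ rest) n T → LegalCover (0 ∷ rest) n (T ∖ Hook (0 ∷ rest) n)) ×
    ((n : ℕ) → 2 * sbar (0 ∷ rest) ≤ n → (T : EdgeSet) →
      LegalCover (0 ∷ rest) (suc n) T → LegalCover (0 ∷ rest) n (T ∖ New (0 ∷ rest) n))
lemma2 rest increasing =
  (λ n _ → cycle-cover⇒legal S bounded n) , (λ n _ → legal-shrink S bounded n)
  where
  S = 0 ∷ rest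
  bounded : Bounded S
  bounded = increasing-bounded increasing
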